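{- Let $(M,\in_1,\in_2)\models ZFC(\in_1)\cup ZFC(\in_2)$. For all $x,x',y,y'\in M$: if $\phi(x,y)$ and $\phi(x,y')$, then $y=y'$; and if $\phi(x,y)$ and $\phi(x',y)$, then $x=x'$.
   Context: $ZFC(\in_1)$ denotes the first-order ZFC axioms with $\in_1$ as membership relation, where formulas in the schemas (Separation, Replacement) may contain both $\in_1$ and $\in_2$; $ZFC(\in_2)$ is symmetric. For $i=1,2$, $\mathrm{tr}_i(x)$ is the formula $\forall t\in_i x\,\forall w\in_i t\,(w\in_i x)$. $\mathrm{TC}_i(x)$ denotes the unique $u$ such that $\mathrm{tr}_i(u)$, $\forall v\in_i x\,(v\in_i u)$, and for every $v$ with $\mathrm{tr}_i(v)\wedge\forall w\in_i x\,(w\in_i v)$ we have $\forall w\in_i u\,(w\in_i v)$ (the $\in_i$-transitive closure of $x$); in $\mathrm{TC}_i(\{x\})$, $\{x\}$ is the singleton in the sense of $\in_i$. $\psi(x,y,f)$ is the conjunction of: (i) in the sense of $\in_1$, $f$ is a function with domain $\mathrm{TC}_1(\{x\})$; (ii) $\forall t\in_1\mathrm{TC}_1(x)\,(f(t)\in_2\mathrm{TC}_2(y))$; (iii) $\forall t\in_2\mathrm{TC}_2(y)\,\exists w\in_1\mathrm{TC}_1(x)\,(t=f(w))$; (iv) $\forall t\in_1\mathrm{TC}_1(x)\,\forall w\in_1\mathrm{TC}_1(\{x\})\,(t\in_1 w\leftrightarrow f(t)\in_2 f(w))$; (v) $f(x)=y$. Function application $f(t)$ is in the sense of $\in_1$.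 $\phi(x,y)$ is the formula $\exists f\,\psi(x,y,f)$. -}

module Defs where

open import Level using (0ℓ)
open import Data.Nat using (ℕ; zero; suc)
open import Data.Empty using (⊥)
open import Data.Product using (Σ; Σ-syntax; _×_)
open import Data.Sum using (_⊎_)
open import Relation.Binary.PropositionalEquality using (_≡_)
open import Relation.Nullary using (¬_)
open import Function.Bundles using (_⇔_)

-- First-order formulas in the language {∈₁, ∈₂, =} (de Bruijn variables)

data Fm : Set where
  mem₁ mem₂ eq : ℕ → ℕ → Fm
  ⊥f            : Fm
  _⇒f_ _∧f_ _∨f_ : Fm → Fm → Fm
  ∀f ∃f         : Fm → Fm

_∷ₑ_ : {M : Set} → M → (ℕ → M) → (ℕ → M)
(a ∷ₑ ρ) zero    = a
(a ∷ₑ ρ) (suc n) = ρ n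

Sat : (M : Set) (E₁ E₂ : M → M → Set) → (ℕ → M) → Fm → Set
Sat M E₁ E₂ ρ (mem₁ i j) = E₁ (ρ i) (ρ j)
Sat M E₁ E₂ ρ (mem₂ i j) = E₂ (ρ i) (ρ j)
Sat M E₁ E₂ ρ (eq i j)   = ρ i ≡ ρ j
Sat M E₁ E₂ ρ ⊥f         = ⊥
Sat M E₁ E₂ ρ (φ ⇒f ψ)   = Sat M E₁ E₂ ρ φ → Sat M E₁ E₂ ρ ψ
Sat M E₁ E₂ ρ (φ ∧f ψ)   = Sat M E₁ E₂ ρ φ × Sat M E₁ E₂ ρ ψ
Sat M E₁ E₂ ρ (φ ∨f ψ)   = Sat M E₁ E₂ ρ φ ⊎ Sat M E₁ E₂ ρ ψ
Sat M E₁ E₂ ρ (∀f φ)     = (a : M) → Sat M E₁ E₂ (a ∷ₑ ρ) φ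
Sat M E₁ E₂ ρ (∃f φ)     = Σ[ a ∈ M ] Sat M E₁ E₂ (a ∷ₑ ρ) φ

-- ZFC(E) in the structure (M, E₁, E₂), where E is the membership
-- relation and schema instances may use both E₁ and E₂ (with parameters).

record ZFC (M : Set) (E₁ E₂ : M → M → Set) (E : M → M → Set) : Set₁ where
  field
    extensionality : ∀ a b → (∀ z → E z a ⇔ E z b) → a ≡ b
    pairing        : ∀ a b → Σ[ p ∈ M ] (∀ z → E z p ⇔ (z ≡ a ⊎ z ≡ b))
    union          : ∀ a → Σ[ u ∈ M ] (∀ z → E z u ⇔ (Σ[ y ∈ M ] (E y a × E z y)))
    power          : ∀ a → Σ[ p ∈ M ] (∀ z → E z p ⇔ (∀ w → E w z → E w a))
    infinity       : Σ[ I ∈ M ] ((Σ[ e ∈ M ] (E e I × (∀ w → ¬ E w e)))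
                       × (∀ x → E x I → Σ[ s ∈ M ] (E s I × (∀ z → E z s ⇔ (E z x ⊎ z ≡ x)))))
    foundation     : ∀ a → Σ[ y ∈ M ] E y a → Σ[ y ∈ M ] (E y a × (∀ z → E z y → ¬ E z a))
    separation     : (φ : Fm) (ρ : ℕ → M) (a : M) →
                     Σ[ b ∈ M ] (∀ c → E c b ⇔ (E c a × Sat M E₁ E₂ (c ∷ₑ ρ) φ))
    replacement    : (φ : Fm) (ρ : ℕ → M) (a : M) →
                     (∀ x → E x a → Σ[ y ∈ M ] (Sat M E₁ E₂ (y ∷ₑ (x ∷ₑ ρ)) φ
                        × (∀ y' → Sat M E₁ E₂ (y' ∷ₑ (x ∷ₑ ρ)) φ → y' ≡ y))) →
                     Σ[ b ∈ M ] (∀ x → E x a → Σ[ y ∈ M ] (E y b × Sat M E₁ E₂ (y ∷ₑ (x ∷ₑ ρ)) φ))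
    choice         : ∀ a → (∀ y → E y a → Σ[ w ∈ M ] E w y) →
                     (∀ y y' → E y a → E y' a → (Σ[ w ∈ M ] (E w y × E w y')) → y ≡ y') →
                     Σ[ c ∈ M ] (∀ y → E y a → Σ[ z ∈ M ] ((E z y × E z c)
                        × (∀ z' → E z' y × E z' c → z' ≡ z)))

module _ {M : Set} (E : M → M → Set) where

  tr : M → Set
  tr x = ∀ t → E t x → ∀ w → E w t → E w x

  IsTC : M → M → Set
  IsTC x u = tr u × (∀ v → E v x → E v u)
           × (∀ v → tr v → (∀ w → E w x → E w v) → ∀ w → E w u → E w v)

  IsSing : M → M → Set
  IsSing x s = ∀ z → E z s ⇔ (z ≡ x)

  IsUPair : M → M → M → Set
  IsUPair a b z = ∀ w → E w z ⇔ (w ≡ a ⊎ w ≡ b)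

  IsPair : M → M → M → Set
  IsPair a b p = ∀ z → E z p ⇔ (IsSing a z ⊎ IsUPair a b z)

  App : M → M → M → Set
  App f t z = Σ[ p ∈ M ] (IsPair t z p × E p f)

  IsFunOn : M → M → Set
  IsFunOn f D = (∀ p → E p f → Σ[ a ∈ M ] Σ[ b ∈ M ] (IsPair a b p × E a D))
              × (∀ a → E a D → Σ[ b ∈ M ] App f a b)
              × (∀ a b b' → App f a b → App f a b' → b ≡ b')

-- ψ(x,y,f); TC₁(x), TC₁({x}), TC₂(y), {x} are named explicitly.
ψ : {M : Set} (E₁ E₂ : M → M → Set) → M → M → M → Set
ψ {M} E₁ E₂ x y f =
  Σ[ sx ∈ M ] Σ[ tsx ∈ M ] Σ[ tx ∈ M ] Σ[ ty ∈ M ]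
    ( IsSing E₁ x sx × IsTC E₁ sx tsx × IsTC E₁ x tx × IsTC E₂ y ty
    × IsFunOn E₁ f tsx
    × (∀ t → E₁ t tx → ∀ z → App E₁ f t z → E₂ z ty)
    × (∀ t → E₂ t ty → Σ[ w ∈ M ] (E₁ w tx × App E₁ f w t))
    × (∀ t w → E₁ t tx → E₁ w tsx → ∀ a b → App E₁ f t a → App E₁ f w b
         → (E₁ t w ⇔ E₂ a b))
    × App E₁ f x y )

ϕ : {M : Set} (E₁ E₂ : M → M → Set) → M → M → Set
ϕ {M} E₁ E₂ x y = Σ[ f ∈ M ] ψ E₁ E₂ x y f

-- Let f witness ϕ(x,y) and g witness ϕ(x,y') (resp. ϕ(x',y)). By ∈₁-induction on TC₁({x}),
-- carried out with Separation and Foundation, g(c) = f(c) for every c ∈₁ TC₁({x}): if f and g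
-- agree below c then f(c) and g(c) have the same ∈₂-members, namely the common images of the
-- ∈₁-members of c, so ∈₂-extensionality gives f(c) = g(c). For injectivity, let c' be the
-- g-preimage of f(c); since g is an ∈₁/∈₂-isomorphism agreeing with f below c, c and c' have the
-- same ∈₁-members, so c = c'. At c = x this yields y = y', resp. g(x) = y = g(x') and x = x'.
module Submission where

open import Defs
open import Level using (0ℓ)
open import Axiom.ExcludedMiddle using (ExcludedMiddle)
open import Data.Product using (_×_; Σ-syntax; _,_; proj₁; proj₂)
open import Data.Sum using (_⊎_; inj₁; inj₂; reduce; map₂)
open import Data.Nat using (ℕ)
open import Relation.Nullary using (¬_)
open import Relation.Nullary.Decidable using (decidable-stable)
open import Relation.Binary.PropositionalEquality using (_≡_; refl; sym; subst)
open import Function.Bundles using (_⇔_; mk⇔; Equivalence)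

open Equivalence

module SetFacts {M : Set} {E₁ E₂ : M → M → Set} (E : M → M → Set) (Z : ZFC M E₁ E₂ E) where
  open ZFC Z

  ext : ∀ {a b} → (∀ z → E z a → E z b) → (∀ z → E z b → E z a) → a ≡ b
  ext a⊆b b⊆a = extensionality _ _ (λ z → mk⇔ (a⊆b z) (b⊆a z))

  same-members-unique : ∀ {P : M → Set} {a b} →
    (∀ z → E z a ⇔ P z) → (∀ z → E z b ⇔ P z) → a ≡ b
  same-members-unique a-spec b-spec = ext (λ z z∈a → from (b-spec z) (to (a-spec z) z∈a))
                                          (λ z z∈b → from (a-spec z) (to (b-spec z) z∈b))

  IsSing-unique : ∀ {x s s'} → IsSing E x s → IsSing E x s' → s ≡ s'
  IsSing-unique = same-members-unique

  IsPair-unique : ∀ {a b p q} → IsPair E a b p → IsPair E a b q → p ≡ q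
  IsPair-unique = same-members-unique

  IsTC-unique : ∀ {x u u'} → IsTC E x u → IsTC E x u' → u ≡ u'
  IsTC-unique (u-tr , x⊆u , u-min) (u'-tr , x⊆u' , u'-min) =
    ext (u-min _ u'-tr x⊆u') (u'-min _ u-tr x⊆u)

  singleton : ∀ a → Σ[ s ∈ M ] IsSing E a s
  singleton a with pairing a a
  ... | s , s-spec = s , λ z → mk⇔ (λ z∈s → reduce (to (s-spec z) z∈s))
                                   (λ z≡a → from (s-spec z) (inj₁ z≡a))

  fst-∈-pair-members : ∀ {a b p} → IsPair E a b p → ∀ s → E s p → E a s
  fst-∈-pair-members {a} p-pair s s∈p with to (p-pair s) s∈p
  ... | inj₁ s-sing  = from (s-sing a) refl
  ... | inj₂ s-upair = from (s-upair a) (inj₁ refl)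

  ∈-pair-members⇒≡fst : ∀ {a b p c} → IsPair E a b p → (∀ s → E s p → E c s) → c ≡ a
  ∈-pair-members⇒≡fst {a} {c = c} p-pair c∈members with singleton a
  ... | s , s-sing = to (s-sing c) (c∈members s (from (p-pair s) (inj₁ s-sing)))

  App-dom : ∀ {f D a b} → IsFunOn E f D → App E f a b → E a D
  App-dom {D = D} {a} (f-pairs , _ , _) (p , p=⟨a,b⟩ , p∈f) with f-pairs p p∈f
  ... | a' , _ , p=⟨a',b'⟩ , a'∈D = subst (λ v → E v D) a'≡a a'∈D
    where
    a'≡a : a' ≡ a
    a'≡a = sym (∈-pair-members⇒≡fst p=⟨a',b'⟩ (fst-∈-pair-members p=⟨a,b⟩))

  binary-union : ∀ a b → Σ[ u ∈ M ] (∀ z → E z u ⇔ (E z a ⊎ E z b))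
  binary-union a b with pairing a b
  ... | p , p-spec with union p
  ... | u , u-spec = u , λ z → mk⇔ (split z) (join z)
    where
    split : ∀ z → E z u → E z a ⊎ E z b
    split z z∈u with to (u-spec z) z∈u
    ... | v , v∈p , z∈v with to (p-spec v) v∈p
    ... | inj₁ refl = inj₁ z∈v
    ... | inj₂ refl = inj₂ z∈v

    join : ∀ z → E z a ⊎ E z b → E z u
    join z (inj₁ z∈a) = from (u-spec z) (a , from (p-spec a) (inj₁ refl) , z∈a)
    join z (inj₂ z∈b) = from (u-spec z) (b , from (p-spec b) (inj₂ refl) , z∈b)

  module _ {x s ts tx} (x-sing : IsSing E x s) (ts-tc : IsTC E s ts) (tx-tc : IsTC E x tx) where

    x∈TC-sing : E x ts
    x∈TC-sing = proj₁ (proj₂ ts-tc) x (from (x-sing x) refl)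

    TC-sing-⊆ : ∀ c → E c ts → E c tx ⊎ c ≡ x
    TC-sing-⊆ c c∈ts with binary-union tx s
    ... | u , u-spec =
      map₂ (λ c∈s → to (x-sing c) c∈s) (to (u-spec c) (ts-min u u-tr s⊆u c c∈ts))
      where
      ts-min : ∀ v → tr E v → (∀ w → E w s → E w v) → ∀ w → E w ts → E w v
      ts-min = proj₂ (proj₂ ts-tc)

      x⊆tx : ∀ w → E w x → E w tx
      x⊆tx = proj₁ (proj₂ tx-tc)

      s⊆u : ∀ w → E w s → E w u
      s⊆u w w∈s = from (u-spec w) (inj₂ w∈s)

      u-tr : tr E u
      u-tr t t∈u w w∈t with to (u-spec t) t∈u
      ... | inj₁ t∈tx = from (u-spec w) (inj₁ (proj₁ tx-tc t t∈tx w w∈t))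
      ... | inj₂ t∈s  = from (u-spec w) (inj₁ (x⊆tx w (subst (E w) (to (x-sing t) t∈s) w∈t)))

    TC-sing-members : ∀ c → E c ts → ∀ w → E w c → E w tx
    TC-sing-members c c∈ts w w∈c with TC-sing-⊆ c c∈ts
    ... | inj₁ c∈tx = proj₁ tx-tc c c∈tx w w∈c
    ... | inj₂ refl = proj₁ (proj₂ tx-tc) w w∈c

  ∈-induction : ExcludedMiddle 0ℓ → (φ : Fm) (ρ : ℕ → M) (D : M) →
    (∀ c → E c D → (∀ w → E w c → E w D → Sat M E₁ E₂ (w ∷ₑ ρ) φ) →
               Sat M E₁ E₂ (c ∷ₑ ρ) φ) →
    ∀ c → E c D → Sat M E₁ E₂ (c ∷ₑ ρ) φ
  ∈-induction em φ ρ D step c c∈D with separation (φ ⇒f ⊥f) ρ D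
  ... | S , S-spec = decidable-stable em λ ¬φc →
                       no-minimal-counterexample (foundation S (c , counterexample c∈D ¬φc))
    where
    counterexample : ∀ {w} → E w D → ¬ Sat M E₁ E₂ (w ∷ₑ ρ) φ → E w S
    counterexample {w} w∈D ¬φw = from (S-spec w) (w∈D , ¬φw)

    no-minimal-counterexample : ¬ (Σ[ m ∈ M ] (E m S × (∀ w → E w m → ¬ E w S)))
    no-minimal-counterexample (m , m∈S , m-min) with to (S-spec m) m∈S
    ... | m∈D , ¬φm = ¬φm (step m m∈D λ w w∈m w∈D →
      decidable-stable em λ ¬φw → m-min w w∈m (counterexample w∈D ¬φw))

module Isomorphism (em : ExcludedMiddle 0ℓ) (M : Set) (E₁ E₂ : M → M → Set)
                   (Z₁ : ZFC M E₁ E₂ E₁) (Z₂ : ZFC M E₁ E₂ E₂) where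
  module S₁ = SetFacts E₁ Z₁
  module S₂ = SetFacts E₂ Z₂

  record Ψ (x y f : M) : Set where
    field
      sx tsx tx ty : M
      x-sing       : IsSing E₁ x sx
      tsx-tc       : IsTC E₁ sx tsx
      tx-tc        : IsTC E₁ x tx
      ty-tc        : IsTC E₂ y ty
      fun          : IsFunOn E₁ f tsx
      into         : ∀ t → E₁ t tx → ∀ z → App E₁ f t z → E₂ z ty
      onto         : ∀ t → E₂ t ty → Σ[ w ∈ M ] (E₁ w tx × App E₁ f w t)
      iso          : ∀ t w → E₁ t tx → E₁ w tsx → ∀ a b →
                     App E₁ f t a → App E₁ f w b → (E₁ t w ⇔ E₂ a b)
      at-x         : App E₁ f x y

  ψ⇒Ψ : ∀ {x y f} → ψ E₁ E₂ x y f → Ψ x y f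
  ψ⇒Ψ (sx , tsx , tx , ty , h₁ , h₂ , h₃ , h₄ , h₅ , h₆ , h₇ , h₈ , h₉) =
    record { sx = sx ; tsx = tsx ; tx = tx ; ty = ty
           ; x-sing = h₁ ; tsx-tc = h₂ ; tx-tc = h₃ ; ty-tc = h₄
           ; fun = h₅ ; into = h₆ ; onto = h₇ ; iso = h₈ ; at-x = h₉ }

  module Ψ-facts {x y f} (W : Ψ x y f) where
    open Ψ W

    x∈tsx : E₁ x tsx
    x∈tsx = S₁.x∈TC-sing x-sing tsx-tc tx-tc

    tsx-tr : tr E₁ tsx
    tsx-tr = proj₁ tsx-tc

    app-functional : ∀ {a b b'} → App E₁ f a b → App E₁ f a b' → b ≡ b'
    app-functional = proj₂ (proj₂ fun) _ _ _

    app-total : ∀ c → E₁ c tsx → Σ[ b ∈ M ] App E₁ f c b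
    app-total = proj₁ (proj₂ fun)

    app-dom : ∀ {a b} → App E₁ f a b → E₁ a tsx
    app-dom = S₁.App-dom fun

    app-below : ∀ {c b w} → App E₁ f c b → E₁ w c → Σ[ z ∈ M ] App E₁ f w z
    app-below {c} {w = w} fc=b w∈c = app-total w (tsx-tr c (app-dom fc=b) w w∈c)

    range : ∀ {c b} → App E₁ f c b → E₂ b ty ⊎ b ≡ y
    range {c} {b} fc=b with S₁.TC-sing-⊆ x-sing tsx-tc tx-tc c (app-dom fc=b)
    ... | inj₁ c∈tx = inj₁ (into c c∈tx b fc=b)
    ... | inj₂ refl = inj₂ (app-functional fc=b at-x)

    range-members : ∀ {c b z} → App E₁ f c b → E₂ z b → E₂ z ty
    range-members {z = z} fc=b z∈b with range fc=b
    ... | inj₁ b∈ty = proj₁ ty-tc _ b∈ty z z∈b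
    ... | inj₂ refl = proj₁ (proj₂ ty-tc) z z∈b

    below-tx : ∀ {c b w} → App E₁ f c b → E₁ w c → E₁ w tx
    below-tx {c} {w = w} fc=b w∈c = S₁.TC-sing-members x-sing tsx-tc tx-tc c (app-dom fc=b) w w∈c

    ∈-app : ∀ {c b w z} → App E₁ f c b → E₁ w c → App E₁ f w z → E₂ z b
    ∈-app {c} {b} {w} {z} fc=b w∈c fw=z =
      to (iso w c (below-tx fc=b w∈c) (app-dom fc=b) z b fw=z fc=b) w∈c

    ∈₂-app : ∀ {c b z} → App E₁ f c b → E₂ z b → Σ[ w ∈ M ] (E₁ w c × App E₁ f w z)
    ∈₂-app {c} {b} {z} fc=b z∈b with onto z (range-members fc=b z∈b)
    ... | w , w∈tx , fw=z = w , from (iso w c w∈tx (app-dom fc=b) z b fw=z fc=b) z∈b , fw=z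

    app-injective : ∀ {a a' z} → App E₁ f a z → App E₁ f a' z → a ≡ a'
    app-injective fa=z fa'=z = S₁.ext (same-image fa=z fa'=z) (same-image fa'=z fa=z)
      where
      same-image : ∀ {a a' z} → App E₁ f a z → App E₁ f a' z → ∀ t → E₁ t a → E₁ t a'
      same-image {a} {a'} {z} fa=z fa'=z t t∈a with app-below fa=z t∈a
      ... | u , ft=u = from (iso t a' t∈tx (app-dom fa'=z) u z ft=u fa'=z)
                            (to (iso t a t∈tx (app-dom fa=z) u z ft=u fa=z) t∈a)
        where
        t∈tx : E₁ t tx
        t∈tx = below-tx fa=z t∈a

  open Ψ

  App⊆ : M → M → M → Set
  App⊆ f g c = ∀ {z} → App E₁ f c z → App E₁ g c z

  -- A definable stand-in for App⊆ f g c, as Separation requires: every pair in f whose first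
  -- coordinate is c (i.e. c lies in all its members) belongs to g. Variables: c, f, g = 0, 1, 2.
  pairs-at-⊆ : Fm
  pairs-at-⊆ = ∀f (mem₁ 0 2 ⇒f (∀f (mem₁ 0 1 ⇒f mem₁ 2 0) ⇒f mem₁ 0 3))

  App⊆-induction : ∀ {D f g} → tr E₁ D → IsFunOn E₁ f D →
    (∀ c → E₁ c D → (∀ w → E₁ w c → App⊆ f g w) → App⊆ f g c) →
    ∀ c → E₁ c D → App⊆ f g c
  App⊆-induction {D} {f} {g} D-tr (f-pairs , _) step c c∈D =
    pairs⇒app (S₁.∈-induction em pairs-at-⊆ ρ D step′ c c∈D)
    where
    ρ : ℕ → M
    ρ = f ∷ₑ (g ∷ₑ λ _ → f)

    PairsAt⊆ : M → Set
    PairsAt⊆ c = Sat M E₁ E₂ (c ∷ₑ ρ) pairs-at-⊆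

    pairs⇒app : ∀ {c} → PairsAt⊆ c → App⊆ f g c
    pairs⇒app pairs-at-c (p , p=⟨c,z⟩ , p∈f) =
      p , p=⟨c,z⟩ , pairs-at-c p p∈f (S₁.fst-∈-pair-members p=⟨c,z⟩)

    app⇒pairs : ∀ {c} → App⊆ f g c → PairsAt⊆ c
    app⇒pairs app-at-c p p∈f c∈members with f-pairs p p∈f
    ... | a , b , p=⟨a,b⟩ , _ with S₁.∈-pair-members⇒≡fst p=⟨a,b⟩ c∈members
    ... | refl with app-at-c (p , p=⟨a,b⟩ , p∈f)
    ... | q , q=⟨a,b⟩ , q∈g = subst (λ r → E₁ r g) (S₁.IsPair-unique q=⟨a,b⟩ p=⟨a,b⟩) q∈g

    step′ : ∀ c → E₁ c D → (∀ w → E₁ w c → E₁ w D → PairsAt⊆ w) → PairsAt⊆ c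
    step′ c c∈D ih =
      app⇒pairs (step c c∈D λ w w∈c → pairs⇒app (ih w w∈c (D-tr c c∈D w w∈c)))

  agree-on-TC-sing : ∀ {x y f g} (F : Ψ x y f) →
    (∀ c → E₁ c (tsx F) → (∀ w → E₁ w c → App⊆ f g w) → App⊆ f g c) → App E₁ g x y
  agree-on-TC-sing F step = App⊆-induction (Ψ-facts.tsx-tr F) (fun F) step _ (Ψ-facts.x∈tsx F) (at-x F)

  ϕ-functional : ∀ {x y y'} → ϕ E₁ E₂ x y → ϕ E₁ E₂ x y' → y ≡ y'
  ϕ-functional {x} {y} {y'} (f , ψf) (g , ψg) = G.app-functional (agree-on-TC-sing F step) (at-x G)
    where
    F : Ψ x y f
    F = ψ⇒Ψ ψf

    G : Ψ x y' g
    G = ψ⇒Ψ ψg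

    module F = Ψ-facts F
    module G = Ψ-facts G

    same-tsx : tsx F ≡ tsx G
    same-tsx = S₁.IsTC-unique (tsx-tc F)
      (subst (λ s → IsTC E₁ s (tsx G)) (S₁.IsSing-unique (x-sing G) (x-sing F)) (tsx-tc G))

    step : ∀ c → E₁ c (tsx F) → (∀ w → E₁ w c → App⊆ f g w) → App⊆ f g c
    step c c∈tsxF ih {b} fc=b with G.app-total c (subst (E₁ c) same-tsx c∈tsxF)
    ... | b' , gc=b' = subst (App E₁ g c) (S₂.ext b'⊆b b⊆b') gc=b'
      where
      b'⊆b : ∀ z → E₂ z b' → E₂ z b
      b'⊆b z z∈b' with G.∈₂-app gc=b' z∈b'
      ... | w , w∈c , gw=z with F.app-below fc=b w∈c
      ... | z′ , fw=z′ =
        subst (λ u → E₂ u b) (G.app-functional (ih w w∈c fw=z′) gw=z) (F.∈-app fc=b w∈c fw=z′)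

      b⊆b' : ∀ z → E₂ z b → E₂ z b'
      b⊆b' z z∈b with F.∈₂-app fc=b z∈b
      ... | w , w∈c , fw=z = G.∈-app gc=b' w∈c (ih w w∈c fw=z)

  ϕ-injective : ∀ {x x' y} → ϕ E₁ E₂ x y → ϕ E₁ E₂ x' y → x ≡ x'
  ϕ-injective {x} {x'} {y} (f , ψf) (g , ψg) = G.app-injective gx=y (at-x G)
    where
    F : Ψ x y f
    F = ψ⇒Ψ ψf

    G : Ψ x' y g
    G = ψ⇒Ψ ψg

    module F = Ψ-facts F
    module G = Ψ-facts G

    preimage : ∀ {c b} → App E₁ f c b → Σ[ c' ∈ M ] App E₁ g c' b
    preimage fc=b with F.range fc=b
    ... | inj₂ refl = x' , at-x G
    ... | inj₁ b∈ty with onto G _ (subst (E₂ _) (S₂.IsTC-unique (ty-tc F) (ty-tc G)) b∈ty)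
    ... | c' , _ , gc'=b = c' , gc'=b

    step : ∀ c → E₁ c (tsx F) → (∀ w → E₁ w c → App⊆ f g w) → App⊆ f g c
    step c _ ih {b} fc=b with preimage fc=b
    ... | c' , gc'=b = subst (λ a → App E₁ g a b) (S₁.ext c'⊆c c⊆c') gc'=b
      where
      c⊆c' : ∀ w → E₁ w c → E₁ w c'
      c⊆c' w w∈c with F.app-below fc=b w∈c
      ... | z , fw=z with G.∈₂-app gc'=b (F.∈-app fc=b w∈c fw=z)
      ... | w′ , w′∈c' , gw′=z =
        subst (λ v → E₁ v c') (G.app-injective gw′=z (ih w w∈c fw=z)) w′∈c'

      c'⊆c : ∀ w → E₁ w c' → E₁ w c
      c'⊆c w w∈c' with G.app-below gc'=b w∈c'
      ... | z , gw=z with F.∈₂-app fc=b (G.∈-app gc'=b w∈c' gw=z)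
      ... | w′ , w′∈c , fw′=z =
        subst (λ v → E₁ v c) (G.app-injective (ih w′ w′∈c fw′=z) gw=z) w′∈c

    gx=y : App E₁ g x y
    gx=y = agree-on-TC-sing F step

lemma3 : ExcludedMiddle 0ℓ → (M : Set) (E₁ E₂ : M → M → Set) →
    ZFC M E₁ E₂ E₁ → ZFC M E₁ E₂ E₂ →
    ∀ x x' y y' →
    (ϕ E₁ E₂ x y → ϕ E₁ E₂ x y' → y ≡ y')
    × (ϕ E₁ E₂ x y → ϕ E₁ E₂ x' y → x ≡ x')
lemma3 em M E₁ E₂ Z₁ Z₂ x x' y y' = ϕ-functional , ϕ-injective
  where open Isomorphism em M E₁ E₂ Z₁ Z₂
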